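{- Let $\mathbf{A}$ be a normal and quasicomplemented distributive nearlattice. Then there exists a one-to-one correspondence (bijection) between the set of $\alpha$-ideals of $A$ and the set of $\alpha$-filters of $A$.
   Context: A distributive nearlattice is a join-semilattice $\langle A,\vee,1\rangle$ with greatest element $1$ in which every principal filter $[a)=\{x\in A\colon a\le x\}$ is a bounded distributive lattice. A filter of $A$ is a subset containing $1$, upward closed, and closed under those binary meets that exist. An ideal is a non-empty subset that is downward closed and closed under $\vee$. For $a\in A$, $a^{\top}=\{x\in A\colon x\vee a=1\}$ and $a^{\top\top}=\{y\in A\colon y\vee x=1\text{ for all }x\in a^{\top}\}$. A filter $F$ is an $\alpha$-filter if $a^{\top\top}\subseteq F$ for all $a\in F$. An ideal $I$ is an $\alpha$-ideal if for each $a\in A$, $I\cap a^{\top\top}\neq\emptyset$ implies $a\in I$. A prime ideal is a proper ideal $P$ with $a\wedge b\in P\Rightarrow a\in P$ or $b\in P$ whenever $a\wedge b$ exists; a maximal ideal is a proper ideal not properly contained in any proper ideal. $\mathbf{A}$ is normal if each prime ideal is contained in a unique maximal ideal; $\mathbf{A}$ is quasicomplemented if for each $a\in A$ there exists $b\in A$ with $a^{\top\top}=b^{\top}$. -}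

module Defs where

open import Level using (Level; suc)
open import Data.Product using (Σ; ∃; ∃-syntax; _×_; _,_; proj₁; proj₂)
open import Data.Sum using (_⊎_)
open import Relation.Nullary using (¬_)
open import Relation.Unary using (Pred; _∈_; _∉_; _⊆_)
open import Relation.Binary.PropositionalEquality using (_≡_)
open import Relation.Binary.Structures using (IsPartialOrder; IsEquivalence)
open import Relation.Binary.Bundles using (Setoid)
open import Function.Bundles using (Bijection)

IsMeet : ∀ {c} {A : Set c} → (A → A → Set c) → A → A → A → Set c
IsMeet _≤_ x y m = (m ≤ x) × (m ≤ y) × (∀ z → z ≤ x → z ≤ y → z ≤ m)

IsMeetIn : ∀ {c} {A : Set c} → (A → A → Set c) → A → A → A → A → Set c
IsMeetIn _≤_ a x y m =
  (a ≤ m) × (m ≤ x) × (m ≤ y) × (∀ z → a ≤ z → z ≤ x → z ≤ y → z ≤ m)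

-- A distributive nearlattice: a join-semilattice ⟨A,∨,1⟩ with greatest element 1
-- in which every principal filter [a) is a bounded distributive lattice
-- (its join is the restriction of ∨, bounds are a and 1, meets are required to
-- exist in [a), and the distributive law holds in [a)).
record DistributiveNearlattice (c : Level) : Set (suc c) where
  infix  4 _≤_
  infixl 6 _∨_
  field
    Carrier        : Set c
    _≤_            : Carrier → Carrier → Set c
    isPartialOrder : IsPartialOrder _≡_ _≤_
    _∨_            : Carrier → Carrier → Carrier
    ∨-upperˡ       : ∀ x y → x ≤ x ∨ y
    ∨-upperʳ       : ∀ x y → y ≤ x ∨ y
    ∨-least        : ∀ x y z → x ≤ z → y ≤ z → x ∨ y ≤ z
    top            : Carrier
    top-max        : ∀ x → x ≤ top
    meetIn         : ∀ a x y → a ≤ x → a ≤ y → ∃[ m ] IsMeetIn _≤_ a x y m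
    distribIn      : ∀ a x y z m p q → a ≤ x → a ≤ y → a ≤ z →
                     IsMeetIn _≤_ a x (y ∨ z) m →
                     IsMeetIn _≤_ a x y p →
                     IsMeetIn _≤_ a x z q →
                     m ≡ p ∨ q

module _ {c : Level} (𝐀 : DistributiveNearlattice c) where
  open DistributiveNearlattice 𝐀

  _ᵀ : Carrier → Pred Carrier c
  (a ᵀ) x = x ∨ a ≡ top

  _ᵀᵀ : Carrier → Pred Carrier c
  (a ᵀᵀ) y = ∀ x → x ∈ (a ᵀ) → y ∨ x ≡ top

  _≐_ : Pred Carrier c → Pred Carrier c → Set c
  P ≐ Q = (P ⊆ Q) × (Q ⊆ P)

  IsFilter : Pred Carrier c → Set c
  IsFilter F = (top ∈ F)
             × (∀ {x y} → x ≤ y → x ∈ F → y ∈ F)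
             × (∀ x y m → IsMeet _≤_ x y m → x ∈ F → y ∈ F → m ∈ F)

  IsIdeal : Pred Carrier c → Set c
  IsIdeal I = (∃[ x ] x ∈ I)
            × (∀ {x y} → x ≤ y → y ∈ I → x ∈ I)
            × (∀ {x y} → x ∈ I → y ∈ I → (x ∨ y) ∈ I)

  IsAlphaFilter : Pred Carrier c → Set c
  IsAlphaFilter F = IsFilter F × (∀ a → a ∈ F → (a ᵀᵀ) ⊆ F)

  IsAlphaIdeal : Pred Carrier c → Set c
  IsAlphaIdeal I = IsIdeal I × (∀ a → (∃[ x ] (x ∈ I × x ∈ (a ᵀᵀ))) → a ∈ I)

  IsProper : Pred Carrier c → Set c
  IsProper P = ¬ (∀ x → x ∈ P)

  IsPrimeIdeal : Pred Carrier c → Set c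
  IsPrimeIdeal P = IsIdeal P × IsProper P
                 × (∀ a b m → IsMeet _≤_ a b m → m ∈ P → (a ∈ P) ⊎ (b ∈ P))

  IsMaximalIdeal : Pred Carrier c → Set (suc c)
  IsMaximalIdeal M = IsIdeal M × IsProper M
                   × (∀ (J : Pred Carrier c) → IsIdeal J → IsProper J → M ⊆ J → J ⊆ M)

  IsNormal : Set (suc c)
  IsNormal = ∀ (P : Pred Carrier c) → IsPrimeIdeal P →
    Σ (Pred Carrier c) λ M → IsMaximalIdeal M × P ⊆ M ×
      (∀ (M′ : Pred Carrier c) → IsMaximalIdeal M′ → P ⊆ M′ → M′ ≐ M)

  IsQuasicomplemented : Set c
  IsQuasicomplemented = ∀ a → ∃[ b ] ((a ᵀᵀ) ≐ (b ᵀ))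

  ≐-isEquivalence : IsEquivalence _≐_
  ≐-isEquivalence = record
    { refl  = (λ z → z) , (λ z → z)
    ; sym   = λ { (f , g) → g , f }
    ; trans = λ { (f , g) (h , k) → (λ z → h (f z)) , (λ z → g (k z)) }
    }

  AlphaIdeals : Setoid (suc c) c
  AlphaIdeals = record
    { Carrier       = Σ (Pred Carrier c) IsAlphaIdeal
    ; _≈_           = λ I J → proj₁ I ≐ proj₁ J
    ; isEquivalence = record
      { refl  = IsEquivalence.refl ≐-isEquivalence
      ; sym   = IsEquivalence.sym ≐-isEquivalence
      ; trans = IsEquivalence.trans ≐-isEquivalence } }

  AlphaFilters : Setoid (suc c) c
  AlphaFilters = record
    { Carrier       = Σ (Pred Carrier c) IsAlphaFilter
    ; _≈_           = λ F G → proj₁ F ≐ proj₁ G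
    ; isEquivalence = record
      { refl  = IsEquivalence.refl ≐-isEquivalence
      ; sym   = IsEquivalence.sym ≐-isEquivalence
      ; trans = IsEquivalence.trans ≐-isEquivalence } }

-- Write a* for a quasicomplement of a, so a^⊤⊤ = (a*)^⊤ and hence a^⊤ = (a*)^⊤⊤.
-- An α-ideal I is sent to the α-filter {x : x ∨ a = 1 for some a ∈ I}, and an α-filter F
-- to the α-ideal {a : a* ∈ F}. The two maps are mutually inverse because the α-closure
-- conditions, read through these two identities, let one pass between a and a* in either
-- direction. Distributivity is needed only for closure under meets: if x ∨ z = y ∨ z = 1
-- then (x ∧ y) ∨ z = 1.
module Submission where

open import Defs
open import Level using (Level)
open import Data.Product using (∃-syntax; _×_; _,_; proj₁; proj₂)
open import Function.Bundles using (Bijection; Inverse)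
open import Function.Definitions using (Congruent; Inverseˡ; Inverseʳ; StrictlyInverseˡ; StrictlyInverseʳ)
open import Function.Properties.Inverse using (Inverse⇒Bijection)
import Function.Consequences.Setoid as SetoidConsequences
open import Relation.Unary using (Pred; _∈_; _⊆_)
open import Relation.Binary.PropositionalEquality using (_≡_; refl; sym; trans; subst)
open import Relation.Binary.Structures using (IsPartialOrder)
open import Relation.Binary.Bundles using (Setoid)
open import Relation.Binary.Lattice using (JoinSemilattice)
import Relation.Binary.Lattice.Properties.JoinSemilattice as JoinSemilatticeProperties

module Coannihilators {c : Level} (𝐀 : DistributiveNearlattice c) where
  open DistributiveNearlattice 𝐀
  open IsPartialOrder isPartialOrder using () renaming (refl to ≤-refl; trans to ≤-trans)

  joinSemilattice : JoinSemilattice c c c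
  joinSemilattice = record
    { isJoinSemilattice = record
      { isPartialOrder = isPartialOrder
      ; supremum       = λ x y → ∨-upperˡ x y , ∨-upperʳ x y , ∨-least x y
      }
    }

  open JoinSemilatticeProperties joinSemilattice using (∨-comm; ∨-assoc; ∨-monotonic)

  infix 10 _⊤ _⊤⊤
  _⊤ _⊤⊤ : Carrier → Pred Carrier c
  _⊤  = _ᵀ 𝐀
  _⊤⊤ = _ᵀᵀ 𝐀

  ≡top-upward : ∀ {u w} → u ≡ top → u ≤ w → w ≡ top
  ≡top-upward {w = w} u≡top u≤w = IsPartialOrder.antisym isPartialOrder (top-max w) (subst (_≤ w) u≡top u≤w)

  ⊤-sym : ∀ {a x} → x ∈ a ⊤ → a ∈ x ⊤
  ⊤-sym {a} {x} x∨a≡top = trans (∨-comm a x) x∨a≡top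

  ∈⊤⊤-self : ∀ a → a ∈ a ⊤⊤
  ∈⊤⊤-self a x = ⊤-sym

  ⊤⊤-∨ : ∀ {a b y} → y ∈ a ⊤⊤ → y ∈ b ⊤⊤ → y ∈ (a ∨ b) ⊤⊤
  ⊤⊤-∨ {a} {b} {y} y∈a⊤⊤ y∈b⊤⊤ z z∨[a∨b]≡top =
    ≡top-upward y∨[y∨z]≡top (∨-least y (y ∨ z) (y ∨ z) (∨-upperˡ y z) ≤-refl)
    where
    y∨[z∨a]≡top : y ∨ (z ∨ a) ≡ top
    y∨[z∨a]≡top = y∈b⊤⊤ (z ∨ a) (trans (∨-assoc z a b) z∨[a∨b]≡top)
    y∨[y∨z]≡top : y ∨ (y ∨ z) ≡ top
    y∨[y∨z]≡top = y∈a⊤⊤ (y ∨ z) (trans (∨-assoc y z a) y∨[z∨a]≡top)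

  meetIn-isMeet : ∀ {a x y m} → IsMeetIn _≤_ a x y m → IsMeet _≤_ x y m
  meetIn-isMeet {a} (a≤m , m≤x , m≤y , greatest) = m≤x , m≤y , λ z z≤x z≤y →
    ≤-trans (∨-upperʳ a z)
      (greatest (a ∨ z) (∨-upperˡ a z)
        (∨-least a z _ (≤-trans a≤m m≤x) z≤x)
        (∨-least a z _ (≤-trans a≤m m≤y) z≤y))

  -- Distributivity in [m): y = y ∧ (x ∨ w) = (y ∧ x) ∨ (y ∧ w) = m ∨ (y ∧ w) ≤ w.
  meet-complement⇒≤ : ∀ {x y m w} → IsMeet _≤_ x y m → m ≤ w → x ∨ w ≡ top → y ≤ w
  meet-complement⇒≤ {x} {y} {m} {w} (m≤x , m≤y , greatest) m≤w x∨w≡top =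
    subst (_≤ w) (sym y≡m∨p) (∨-least m p w m≤w p≤w)
    where
    y∧w = meetIn m y w m≤y m≤w
    p   = proj₁ y∧w
    p≤w : p ≤ w
    p≤w = proj₁ (proj₂ (proj₂ (proj₂ y∧w)))
    y∧[x∨w]≡y : IsMeetIn _≤_ m y (x ∨ w) y
    y∧[x∨w]≡y = m≤y , ≤-refl , subst (y ≤_) (sym x∨w≡top) (top-max y) , λ z _ z≤y _ → z≤y
    y∧x≡m : IsMeetIn _≤_ m y x m
    y∧x≡m = ≤-refl , m≤y , m≤x , λ z _ z≤y z≤x → greatest z z≤x z≤y
    y≡m∨p : y ≡ m ∨ p
    y≡m∨p = distribIn m y x w y m p m≤y m≤x m≤w y∧[x∨w]≡y y∧x≡m (proj₂ y∧w)

  meet-∨≡top : ∀ {x y m z} → IsMeet _≤_ x y m → x ∨ z ≡ top → y ∨ z ≡ top → m ∨ z ≡ top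
  meet-∨≡top {_} {y} {m} {z} meet x∨z≡top y∨z≡top =
    ≡top-upward y∨w≡top (∨-least y w w y≤w ≤-refl)
    where
    w = m ∨ z
    z≤w : z ≤ w
    z≤w = ∨-upperʳ m z
    y∨w≡top : y ∨ w ≡ top
    y∨w≡top = ≡top-upward y∨z≡top (∨-monotonic ≤-refl z≤w)
    y≤w : y ≤ w
    y≤w = meet-complement⇒≤ meet (∨-upperˡ m z) (≡top-upward x∨z≡top (∨-monotonic ≤-refl z≤w))

  filterOf : Pred Carrier c → Pred Carrier c
  filterOf I x = ∃[ a ] (a ∈ I × x ∈ a ⊤)

  filterOf-mono : ∀ {I J} → I ⊆ J → filterOf I ⊆ filterOf J
  filterOf-mono I⊆J (a , a∈I , x∈a⊤) = a , I⊆J a∈I , x∈a⊤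

  filterOf-isAlphaFilter : ∀ {I} → IsIdeal 𝐀 I → IsAlphaFilter 𝐀 (filterOf I)
  filterOf-isAlphaFilter {I} ((a , a∈I) , _ , ∨-closed) =
    ( (a , a∈I , ≡top-upward refl (∨-upperˡ top a))
    , (λ x≤y (a , a∈I , x∈a⊤) → a , a∈I , ≡top-upward x∈a⊤ (∨-monotonic x≤y ≤-refl))
    , meet-closed )
    , λ x (a , a∈I , x∈a⊤) y∈x⊤⊤ → a , a∈I , y∈x⊤⊤ a (⊤-sym x∈a⊤)
    where
    meet-closed : ∀ x y m → IsMeet _≤_ x y m → x ∈ filterOf I → y ∈ filterOf I → m ∈ filterOf I
    meet-closed x y m meet (a , a∈I , x∈a⊤) (b , b∈I , y∈b⊤) =
      a ∨ b , ∨-closed a∈I b∈I ,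
      meet-∨≡top meet (≡top-upward x∈a⊤ (∨-monotonic ≤-refl (∨-upperˡ a b)))
                      (≡top-upward y∈b⊤ (∨-monotonic ≤-refl (∨-upperʳ a b)))

module Quasicomplements {c : Level} (𝐀 : DistributiveNearlattice c)
                        (quasicomplemented : IsQuasicomplemented 𝐀) where
  open DistributiveNearlattice 𝐀
  open Coannihilators 𝐀
  open JoinSemilatticeProperties joinSemilattice using (∨-assoc; ∨-monotonic)
  open IsPartialOrder isPartialOrder using () renaming (refl to ≤-refl)

  _* : Carrier → Carrier
  a * = proj₁ (quasicomplemented a)

  ⊤⊤⊆*⊤ : ∀ a → a ⊤⊤ ⊆ a * ⊤
  ⊤⊤⊆*⊤ a = proj₁ (proj₂ (quasicomplemented a))

  *⊤⊆⊤⊤ : ∀ a → a * ⊤ ⊆ a ⊤⊤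
  *⊤⊆⊤⊤ a = proj₂ (proj₂ (quasicomplemented a))

  ∨-* : ∀ a → a ∨ a * ≡ top
  ∨-* a = ⊤⊤⊆*⊤ a (∈⊤⊤-self a)

  ⊤⊆*⊤⊤ : ∀ a → a ⊤ ⊆ a * ⊤⊤
  ⊤⊆*⊤⊤ a y∈a⊤ x x∈a*⊤ = ⊤-sym (*⊤⊆⊤⊤ a x∈a*⊤ _ y∈a⊤)

  **∈⊤⊤ : ∀ a → a * * ∈ a ⊤⊤
  **∈⊤⊤ a = *⊤⊆⊤⊤ a (⊤-sym (∨-* (a *)))

  *-antitone : ∀ {a b} → a ≤ b → a * ∈ b * ⊤⊤
  *-antitone {a} {b} a≤b = ⊤⊆*⊤⊤ b (≡top-upward (⊤-sym (∨-* a)) (∨-monotonic ≤-refl a≤b))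

  idealOf : Pred Carrier c → Pred Carrier c
  idealOf F a = a * ∈ F

  idealOf-mono : ∀ {F G} → F ⊆ G → idealOf F ⊆ idealOf G
  idealOf-mono F⊆G = F⊆G

  -- With d = (a ∨ b)*, the meet m of d ∨ a* and d ∨ b* is in F, and d ∈ m^⊤⊤.
  idealOf-∨-closed : ∀ {F a b} → IsAlphaFilter 𝐀 F → a * ∈ F → b * ∈ F → (a ∨ b) * ∈ F
  idealOf-∨-closed {F} {a} {b} ((_ , upward , meet-closed) , α) a*∈F b*∈F =
    α m m∈F d∈m⊤⊤
    where
    d = (a ∨ b) *
    d∨a*∧d∨b* = meetIn d (d ∨ a *) (d ∨ b *) (∨-upperˡ d (a *)) (∨-upperˡ d (b *))
    m = proj₁ d∨a*∧d∨b*
    meet : IsMeet _≤_ (d ∨ a *) (d ∨ b *) m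
    meet = meetIn-isMeet (proj₂ d∨a*∧d∨b*)
    m∈F : m ∈ F
    m∈F = meet-closed _ _ m meet (upward (∨-upperʳ d (a *)) a*∈F) (upward (∨-upperʳ d (b *)) b*∈F)
    x∨d∈⊤⊤ : ∀ {x e} → m ≤ d ∨ e * → x ∈ m ⊤ → x ∨ d ∈ e ⊤⊤
    x∨d∈⊤⊤ {x} {e} m≤d∨e* x∨m≡top =
      *⊤⊆⊤⊤ e (≡top-upward x∨m≡top
        (subst (x ∨ m ≤_) (sym (∨-assoc x d (e *))) (∨-monotonic ≤-refl m≤d∨e*)))
    d∈m⊤⊤ : d ∈ m ⊤⊤
    d∈m⊤⊤ x x∨m≡top = ≡top-upward [x∨d]∨d≡top
      (∨-least (x ∨ d) d (d ∨ x) (∨-least x d _ (∨-upperʳ d x) (∨-upperˡ d x)) (∨-upperˡ d x))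
      where
      [x∨d]∨d≡top : x ∨ d ∨ d ≡ top
      [x∨d]∨d≡top = ⊤⊤⊆*⊤ (a ∨ b)
        (⊤⊤-∨ (x∨d∈⊤⊤ (proj₁ meet) x∨m≡top) (x∨d∈⊤⊤ (proj₁ (proj₂ meet)) x∨m≡top))

  idealOf-isAlphaIdeal : ∀ {F} → IsAlphaFilter 𝐀 F → IsAlphaIdeal 𝐀 (idealOf F)
  idealOf-isAlphaIdeal αF@((top∈F , _) , α) =
    ( (top * , α top top∈F (**∈⊤⊤ top))
    , (λ {_} {b} a≤b b*∈F → α (b *) b*∈F (*-antitone a≤b))
    , idealOf-∨-closed αF )
    , λ a (x , x*∈F , x∈a⊤⊤) → α (x *) x*∈F (⊤⊆*⊤⊤ x (⊤-sym (⊤⊤⊆*⊤ a x∈a⊤⊤)))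

  idealOf-filterOf : ∀ {I} → IsAlphaIdeal 𝐀 I → _≐_ 𝐀 (idealOf (filterOf I)) I
  idealOf-filterOf (_ , α) =
      (λ {a} (b , b∈I , a*∈b⊤) → α a (b , b∈I , *⊤⊆⊤⊤ a (⊤-sym a*∈b⊤)))
    , (λ {a} a∈I → a , a∈I , ⊤-sym (∨-* a))

  filterOf-idealOf : ∀ {F} → IsAlphaFilter 𝐀 F → _≐_ 𝐀 (filterOf (idealOf F)) F
  filterOf-idealOf (_ , α) =
      (λ (a , a*∈F , x∈a⊤) → α (a *) a*∈F (⊤⊆*⊤⊤ a x∈a⊤))
    , (λ {x} x∈F → x * , α x x∈F (**∈⊤⊤ x) , ∨-* x)

  alphaIdeals↔alphaFilters : Inverse (AlphaIdeals 𝐀) (AlphaFilters 𝐀)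
  alphaIdeals↔alphaFilters = record
    { to        = to
    ; from      = from
    ; to-cong   = λ {I} {J} → to-cong {I} {J}
    ; from-cong = λ {F} {G} → from-cong {F} {G}
    ; inverse   = (λ {F} {I} → inverseˡ {F} {I}) , (λ {I} {F} → inverseʳ {I} {F})
    }
    where
    -- Both equalities only look at the underlying subsets, so the implicit arguments
    -- of congruences and inverse laws cannot be inferred and are passed explicitly.
    open Setoid (AlphaIdeals 𝐀) using () renaming (Carrier to AlphaIdeal; _≈_ to _≈ᴵ_)
    open Setoid (AlphaFilters 𝐀) using () renaming (Carrier to AlphaFilter; _≈_ to _≈ᶠ_)
    open SetoidConsequences (AlphaIdeals 𝐀) (AlphaFilters 𝐀)

    to : AlphaIdeal → AlphaFilter
    to (I , αI) = filterOf I , filterOf-isAlphaFilter (proj₁ αI)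

    from : AlphaFilter → AlphaIdeal
    from (F , αF) = idealOf F , idealOf-isAlphaIdeal αF

    to-cong : Congruent _≈ᴵ_ _≈ᶠ_ to
    to-cong {I , _} {J , _} (I⊆J , J⊆I) = filterOf-mono {I} {J} I⊆J , filterOf-mono {J} {I} J⊆I

    from-cong : Congruent _≈ᶠ_ _≈ᴵ_ from
    from-cong {F , _} {G , _} (F⊆G , G⊆F) = idealOf-mono {F} {G} F⊆G , idealOf-mono {G} {F} G⊆F

    to∘from≈id : StrictlyInverseˡ _≈ᶠ_ to from
    to∘from≈id (F , αF) = filterOf-idealOf αF

    from∘to≈id : StrictlyInverseʳ _≈ᴵ_ to from
    from∘to≈id (I , αI) = idealOf-filterOf αI

    inverseˡ : Inverseˡ _≈ᴵ_ _≈ᶠ_ to from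
    inverseˡ {F} {I} =
      strictlyInverseˡ⇒inverseˡ {f = to} {f⁻¹ = from} (λ {I} {J} → to-cong {I} {J}) to∘from≈id {F} {I}

    inverseʳ : Inverseʳ _≈ᴵ_ _≈ᶠ_ to from
    inverseʳ {I} {F} =
      strictlyInverseʳ⇒inverseʳ {f⁻¹ = from} {f = to} (λ {F} {G} → from-cong {F} {G}) from∘to≈id {I} {F}

theorem3p14 : ∀ {c : Level} (𝐀 : DistributiveNearlattice c) →
    IsNormal 𝐀 → IsQuasicomplemented 𝐀 →
    Bijection (AlphaIdeals 𝐀) (AlphaFilters 𝐀)
theorem3p14 𝐀 _ quasicomplemented =
  Inverse⇒Bijection (Quasicomplements.alphaIdeals↔alphaFilters 𝐀 quasicomplemented)
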